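{- Let $n\ge 3$ be an odd integer and $k\ge 3$ an integer. Then $k$ divides $n$ if and only if $i(C_k,x)$ divides $i(C_n,x)$ (as polynomials).
   Context: The independence polynomial of a graph $G$ is $i(G,x)=\sum_{j\ge 0} i_j x^j$, where $i_j$ is the number of independent sets (vertex sets inducing no edges) of size $j$ in $G$. $C_m$ denotes the cycle on $m$ vertices ($m\ge 3$). -}

module Defs where

open import Data.Bool using (Bool; true; false; _∧_; not; if_then_else_)
open import Data.Nat using (ℕ; zero; suc; _%_; _≡ᵇ_)
open import Data.Fin using (Fin; toℕ)
open import Data.Fin.Subset using (Subset; ∣_∣)
open import Data.Vec using (Vec; []; _∷_; lookup)
open import Data.List using (List; []; _∷_; _++_; map; filter; length; upTo; allFin; foldr)
open import Data.Integer using (ℤ; +_; _+_; _*_)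
open import Data.Product using (∃)
open import Relation.Binary.PropositionalEquality using (_≡_)
open import Relation.Nullary.Decidable using (Dec; yes; no)
open import Data.Bool.Properties using (T?)
open import Data.Bool using (T)

record Graph : Set where
  field
    order : ℕ
    adj   : Fin order → Fin order → Bool
open Graph public

-- The cycle C_m on vertices 0,…,m-1: i ~ j iff j ≡ i+1 (mod m) or
-- i ≡ j+1 (mod m).  (Meant to be used for m ≥ 3.)
cycleGraph : ℕ → Graph
cycleGraph zero = record { order = zero ; adj = λ _ _ → false }
cycleGraph (suc m) = record
  { order = suc m
  ; adj   = λ i j → (toℕ j ≡ᵇ ((suc (toℕ i)) % suc m))
                    Data.Bool.∨ (toℕ i ≡ᵇ ((suc (toℕ j)) % suc m))
  }

allSubsets : (m : ℕ) → List (Subset m)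
allSubsets zero    = [] ∷ []
allSubsets (suc m) = map (true ∷_) (allSubsets m) ++ map (false ∷_) (allSubsets m)

allᵇ : {A : Set} → (A → Bool) → List A → Bool
allᵇ p = foldr (λ x b → p x ∧ b) true

isIndependent : (G : Graph) → Subset (order G) → Bool
isIndependent G S =
  allᵇ (λ i → allᵇ (λ j → not (adj G i j ∧ lookup S i ∧ lookup S j)) (allFin (order G)))
      (allFin (order G))

indepCount : Graph → ℕ → ℕ
indepCount G j =
  length (filter (λ S → T? (isIndependent G S ∧ (∣ S ∣ ≡ᵇ j))) (allSubsets (order G)))

-- Polynomials with integer coefficients, as coefficient lists
-- (constant term first); equality is coefficientwise (trailing zeros
-- irrelevant).

Poly : Set
Poly = List ℤ

coeff : Poly → ℕ → ℤ
coeff []      _       = + 0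
coeff (a ∷ p) zero    = a
coeff (a ∷ p) (suc n) = coeff p n

_+ₚ_ : Poly → Poly → Poly
[]      +ₚ q       = q
(a ∷ p) +ₚ []      = a ∷ p
(a ∷ p) +ₚ (b ∷ q) = (a + b) ∷ (p +ₚ q)

_*ₚ_ : Poly → Poly → Poly
[]      *ₚ q = []
(a ∷ p) *ₚ q = map (a *_) q +ₚ (+ 0 ∷ (p *ₚ q))

_≈ₚ_ : Poly → Poly → Set
p ≈ₚ q = ∀ n → coeff p n ≡ coeff q n

_∣ₚ_ : Poly → Poly → Set
p ∣ₚ q = ∃ λ r → (p *ₚ r) ≈ₚ q

indepPoly : Graph → Poly
indepPoly G = map (λ j → + indepCount G j) (upTo (suc (order G)))

-- The independence polynomial of C_n is the Lucas polynomial L_n (L₀ = 2, L₁ = 1,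
-- L_{n+2} = L_{n+1} + x L_n): deciding whether the first vertex of the cycle is
-- chosen reduces the count to paths with fixed end conditions, whose counts obey the
-- same recurrence.  The addition formula L_{m+2k} + (-x)^k L_m = L_{m+k} L_k gives
-- L_k ∣ L_m ⇒ L_k ∣ L_{m+2k}, hence L_k ∣ L_{(2t+1)k}; this is where n odd is used.
-- Conversely, evaluating at x = 1 turns L_k ∣ L_n into a divisibility of Lucas
-- numbers, where (-1)^k is a unit, so the same formula lets one pass from n to
-- n - 2k, and from n to 2k - n when k < n < 2k.  Since L_k > L_s for s < k, this
-- leaves n ≡ 0 or k modulo 2k, and in both cases k ∣ n.

module Submission where

open import Defs
open import Data.Nat using (ℕ; _≤_; _%_)
open import Data.Nat.Divisibility using (_∣_)
open import Function.Bundles using (_⇔_)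
open import Relation.Binary.PropositionalEquality using (_≡_)

module IntegerPolynomials where

  open import Algebra.Bundles using (CommutativeRing)
  open import Algebra.Solver.Ring.AlmostCommutativeRing
    using (fromCommutativeRing; _-Raw-AlmostCommutative⟶_)
  open import Data.Integer using (ℤ; +_; -_; +-*-rawRing) renaming (_+_ to _+ᶻ_; _*_ to _*ᶻ_; _≟_ to _≟ᶻ_)
  open import Data.Integer.Properties as ℤ using ()
  open import Data.Integer.Tactic.RingSolver using (solve-∀)
  open import Data.List using ([]; _∷_; map)
  open import Data.Maybe using (Maybe; just; nothing)
  open import Data.Nat using (zero; suc)
  open import Data.Product using (_,_)
  open import Relation.Binary.PropositionalEquality
    using (refl; sym; trans; cong; cong₂; module ≡-Reasoning)
  open import Relation.Nullary using (yes; no)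
  open ≡-Reasoning

  -ₚ_ : Poly → Poly
  -ₚ_ = map (-_)

  1ₚ : Poly
  1ₚ = + 1 ∷ []

  X : Poly
  X = + 0 ∷ + 1 ∷ []

  ∷-cong : ∀ a {p q} → p ≈ₚ q → (a ∷ p) ≈ₚ (a ∷ q)
  ∷-cong a p≈q zero    = refl
  ∷-cong a p≈q (suc n) = p≈q n

  coeff-+ₚ : ∀ p q n → coeff (p +ₚ q) n ≡ coeff p n +ᶻ coeff q n
  coeff-+ₚ []      q       n       = sym (ℤ.+-identityˡ _)
  coeff-+ₚ (a ∷ p) []      n       = sym (ℤ.+-identityʳ _)
  coeff-+ₚ (a ∷ p) (b ∷ q) zero    = refl
  coeff-+ₚ (a ∷ p) (b ∷ q) (suc n) = coeff-+ₚ p q n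

  coeff-map-* : ∀ a q n → coeff (map (a *ᶻ_) q) n ≡ a *ᶻ coeff q n
  coeff-map-* a []      n       = sym (ℤ.*-zeroʳ a)
  coeff-map-* a (b ∷ q) zero    = refl
  coeff-map-* a (b ∷ q) (suc n) = coeff-map-* a q n

  coeff-negate : ∀ p n → coeff (-ₚ p) n ≡ - coeff p n
  coeff-negate []      n       = refl
  coeff-negate (a ∷ p) zero    = refl
  coeff-negate (a ∷ p) (suc n) = coeff-negate p n

  coeff-∷-*ₚ : ∀ a p q n →
    coeff ((a ∷ p) *ₚ q) n ≡ a *ᶻ coeff q n +ᶻ coeff (+ 0 ∷ (p *ₚ q)) n
  coeff-∷-*ₚ a p q n = trans (coeff-+ₚ (map (a *ᶻ_) q) (+ 0 ∷ (p *ₚ q)) n)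
                             (cong (_+ᶻ coeff (+ 0 ∷ (p *ₚ q)) n) (coeff-map-* a q n))

  0∷-≈ₚ-[] : ∀ {p} → p ≈ₚ [] → (+ 0 ∷ p) ≈ₚ []
  0∷-≈ₚ-[] p≈0 zero    = refl
  0∷-≈ₚ-[] p≈0 (suc n) = p≈0 n

  *ₚ-zeroˡ : ∀ p q → p ≈ₚ [] → (p *ₚ q) ≈ₚ []
  *ₚ-zeroˡ []      q p≈0 n = refl
  *ₚ-zeroˡ (a ∷ p) q p≈0 n = begin
    coeff ((a ∷ p) *ₚ q) n                     ≡⟨ coeff-∷-*ₚ a p q n ⟩
    a *ᶻ coeff q n +ᶻ coeff (+ 0 ∷ (p *ₚ q)) n ≡⟨ cong₂ (λ u v → u *ᶻ coeff q n +ᶻ v) (p≈0 zero)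
                                                   (0∷-≈ₚ-[] {p *ₚ q} (*ₚ-zeroˡ p q (λ m → p≈0 (suc m))) n) ⟩
    + 0 *ᶻ coeff q n +ᶻ + 0                    ≡⟨ ℤ.+-identityʳ _ ⟩
    + 0 *ᶻ coeff q n                           ≡⟨ ℤ.*-zeroˡ (coeff q n) ⟩
    + 0                                        ∎

  *ₚ-zeroʳ : ∀ p → (p *ₚ []) ≈ₚ []
  *ₚ-zeroʳ []      n = refl
  *ₚ-zeroʳ (a ∷ p) n = begin
    coeff ((a ∷ p) *ₚ []) n               ≡⟨ coeff-∷-*ₚ a p [] n ⟩
    a *ᶻ + 0 +ᶻ coeff (+ 0 ∷ (p *ₚ [])) n ≡⟨ cong₂ _+ᶻ_ (ℤ.*-zeroʳ a) (0∷-≈ₚ-[] {p *ₚ []} (*ₚ-zeroʳ p) n) ⟩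
    + 0                                   ∎

  *ₚ-congʳ : ∀ {p p'} q → p ≈ₚ p' → (p *ₚ q) ≈ₚ (p' *ₚ q)
  *ₚ-congʳ {[]}    {[]}      q p≈p' n = refl
  *ₚ-congʳ {[]}    {a' ∷ p'} q p≈p' n = sym (*ₚ-zeroˡ (a' ∷ p') q (λ m → sym (p≈p' m)) n)
  *ₚ-congʳ {a ∷ p} {[]}      q p≈p' n = *ₚ-zeroˡ (a ∷ p) q p≈p' n
  *ₚ-congʳ {a ∷ p} {a' ∷ p'} q p≈p' n = begin
    coeff ((a ∷ p) *ₚ q) n                       ≡⟨ coeff-∷-*ₚ a p q n ⟩
    a *ᶻ coeff q n +ᶻ coeff (+ 0 ∷ (p *ₚ q)) n   ≡⟨ cong₂ (λ u v → u *ᶻ coeff q n +ᶻ v) (p≈p' zero)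
                                                     (∷-cong (+ 0) (*ₚ-congʳ {p} {p'} q (λ m → p≈p' (suc m))) n) ⟩
    a' *ᶻ coeff q n +ᶻ coeff (+ 0 ∷ (p' *ₚ q)) n ≡⟨ sym (coeff-∷-*ₚ a' p' q n) ⟩
    coeff ((a' ∷ p') *ₚ q) n                     ∎

  *ₚ-congˡ : ∀ p {q q'} → q ≈ₚ q' → (p *ₚ q) ≈ₚ (p *ₚ q')
  *ₚ-congˡ []      q≈q' n = refl
  *ₚ-congˡ (a ∷ p) {q} {q'} q≈q' n = begin
    coeff ((a ∷ p) *ₚ q) n                      ≡⟨ coeff-∷-*ₚ a p q n ⟩
    a *ᶻ coeff q n +ᶻ coeff (+ 0 ∷ (p *ₚ q)) n  ≡⟨ cong₂ (λ u v → a *ᶻ u +ᶻ v) (q≈q' n)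
                                                    (∷-cong (+ 0) (*ₚ-congˡ p {q} {q'} q≈q') n) ⟩
    a *ᶻ coeff q' n +ᶻ coeff (+ 0 ∷ (p *ₚ q')) n ≡⟨ sym (coeff-∷-*ₚ a p q' n) ⟩
    coeff ((a ∷ p) *ₚ q') n                     ∎

  +ₚ-cong : ∀ {p p' q q'} → p ≈ₚ p' → q ≈ₚ q' → (p +ₚ q) ≈ₚ (p' +ₚ q')
  +ₚ-cong {p} {p'} {q} {q'} p≈p' q≈q' n = begin
    coeff (p +ₚ q) n         ≡⟨ coeff-+ₚ p q n ⟩
    coeff p n +ᶻ coeff q n   ≡⟨ cong₂ _+ᶻ_ (p≈p' n) (q≈q' n) ⟩
    coeff p' n +ᶻ coeff q' n ≡⟨ sym (coeff-+ₚ p' q' n) ⟩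
    coeff (p' +ₚ q') n       ∎

  -ₚ-cong : ∀ {p p'} → p ≈ₚ p' → (-ₚ p) ≈ₚ (-ₚ p')
  -ₚ-cong {p} {p'} p≈p' n = trans (coeff-negate p n) (trans (cong -_ (p≈p' n)) (sym (coeff-negate p' n)))

  +ₚ-assoc : ∀ p q r → ((p +ₚ q) +ₚ r) ≈ₚ (p +ₚ (q +ₚ r))
  +ₚ-assoc p q r n
    rewrite coeff-+ₚ (p +ₚ q) r n | coeff-+ₚ p q n | coeff-+ₚ p (q +ₚ r) n | coeff-+ₚ q r n
    = ℤ.+-assoc (coeff p n) (coeff q n) (coeff r n)

  +ₚ-comm : ∀ p q → (p +ₚ q) ≈ₚ (q +ₚ p)
  +ₚ-comm p q n rewrite coeff-+ₚ p q n | coeff-+ₚ q p n = ℤ.+-comm (coeff p n) (coeff q n)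

  +ₚ-identityʳ : ∀ p → (p +ₚ []) ≈ₚ p
  +ₚ-identityʳ p n rewrite coeff-+ₚ p [] n = ℤ.+-identityʳ (coeff p n)

  -ₚ-inverseˡ : ∀ p → ((-ₚ p) +ₚ p) ≈ₚ []
  -ₚ-inverseˡ p n rewrite coeff-+ₚ (-ₚ p) p n | coeff-negate p n = ℤ.+-inverseˡ (coeff p n)

  -ₚ-inverseʳ : ∀ p → (p +ₚ (-ₚ p)) ≈ₚ []
  -ₚ-inverseʳ p n rewrite coeff-+ₚ p (-ₚ p) n | coeff-negate p n = ℤ.+-inverseʳ (coeff p n)

  *ₚ-identityˡ : ∀ p → (1ₚ *ₚ p) ≈ₚ p
  *ₚ-identityˡ p n = begin
    coeff (1ₚ *ₚ p) n                        ≡⟨ coeff-∷-*ₚ (+ 1) [] p n ⟩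
    + 1 *ᶻ coeff p n +ᶻ coeff (+ 0 ∷ []) n   ≡⟨ cong (+ 1 *ᶻ coeff p n +ᶻ_) (0∷-≈ₚ-[] {[]} (λ _ → refl) n) ⟩
    + 1 *ᶻ coeff p n +ᶻ + 0                  ≡⟨ ℤ.+-identityʳ _ ⟩
    + 1 *ᶻ coeff p n                         ≡⟨ ℤ.*-identityˡ _ ⟩
    coeff p n                                ∎

  *ₚ-distribˡ : ∀ p q r → (p *ₚ (q +ₚ r)) ≈ₚ ((p *ₚ q) +ₚ (p *ₚ r))
  *ₚ-distribˡ []      q r n = refl
  *ₚ-distribˡ (a ∷ p) q r n = begin
    coeff ((a ∷ p) *ₚ (q +ₚ r)) n
      ≡⟨ coeff-∷-*ₚ a p (q +ₚ r) n ⟩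
    a *ᶻ coeff (q +ₚ r) n +ᶻ coeff (+ 0 ∷ (p *ₚ (q +ₚ r))) n
      ≡⟨ cong₂ (λ u v → a *ᶻ u +ᶻ v) (coeff-+ₚ q r n) (∷-cong (+ 0) (*ₚ-distribˡ p q r) n) ⟩
    a *ᶻ (coeff q n +ᶻ coeff r n) +ᶻ coeff ((+ 0 ∷ (p *ₚ q)) +ₚ (+ 0 ∷ (p *ₚ r))) n
      ≡⟨ cong (a *ᶻ (coeff q n +ᶻ coeff r n) +ᶻ_) (coeff-+ₚ (+ 0 ∷ (p *ₚ q)) (+ 0 ∷ (p *ₚ r)) n) ⟩
    a *ᶻ (coeff q n +ᶻ coeff r n) +ᶻ (coeff (+ 0 ∷ (p *ₚ q)) n +ᶻ coeff (+ 0 ∷ (p *ₚ r)) n)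
      ≡⟨ distrib a (coeff q n) (coeff r n) _ _ ⟩
    (a *ᶻ coeff q n +ᶻ coeff (+ 0 ∷ (p *ₚ q)) n) +ᶻ (a *ᶻ coeff r n +ᶻ coeff (+ 0 ∷ (p *ₚ r)) n)
      ≡⟨ sym (cong₂ _+ᶻ_ (coeff-∷-*ₚ a p q n) (coeff-∷-*ₚ a p r n)) ⟩
    coeff ((a ∷ p) *ₚ q) n +ᶻ coeff ((a ∷ p) *ₚ r) n
      ≡⟨ sym (coeff-+ₚ ((a ∷ p) *ₚ q) ((a ∷ p) *ₚ r) n) ⟩
    coeff (((a ∷ p) *ₚ q) +ₚ ((a ∷ p) *ₚ r)) n
      ∎
    where
    distrib : ∀ a b c d e → a *ᶻ (b +ᶻ c) +ᶻ (d +ᶻ e) ≡ (a *ᶻ b +ᶻ d) +ᶻ (a *ᶻ c +ᶻ e)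
    distrib = solve-∀

  *ₚ-∷ : ∀ p b q → (p *ₚ (b ∷ q)) ≈ₚ (map (b *ᶻ_) p +ₚ (+ 0 ∷ (p *ₚ q)))
  *ₚ-∷ []      b q zero    = refl
  *ₚ-∷ []      b q (suc n) = refl
  *ₚ-∷ (a ∷ p) b q zero    = cong (_+ᶻ + 0) (ℤ.*-comm a b)
  *ₚ-∷ (a ∷ p) b q (suc n) = begin
    coeff ((a ∷ p) *ₚ (b ∷ q)) (suc n)
      ≡⟨ coeff-∷-*ₚ a p (b ∷ q) (suc n) ⟩
    a *ᶻ coeff q n +ᶻ coeff (p *ₚ (b ∷ q)) n
      ≡⟨ cong (a *ᶻ coeff q n +ᶻ_) (*ₚ-∷ p b q n) ⟩
    a *ᶻ coeff q n +ᶻ coeff (map (b *ᶻ_) p +ₚ (+ 0 ∷ (p *ₚ q))) n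
      ≡⟨ cong (a *ᶻ coeff q n +ᶻ_) (coeff-+ₚ (map (b *ᶻ_) p) (+ 0 ∷ (p *ₚ q)) n) ⟩
    a *ᶻ coeff q n +ᶻ (coeff (map (b *ᶻ_) p) n +ᶻ coeff (+ 0 ∷ (p *ₚ q)) n)
      ≡⟨ exchange (a *ᶻ coeff q n) (coeff (map (b *ᶻ_) p) n) (coeff (+ 0 ∷ (p *ₚ q)) n) ⟩
    coeff (map (b *ᶻ_) p) n +ᶻ (a *ᶻ coeff q n +ᶻ coeff (+ 0 ∷ (p *ₚ q)) n)
      ≡⟨ cong (coeff (map (b *ᶻ_) p) n +ᶻ_) (sym (coeff-∷-*ₚ a p q n)) ⟩
    coeff (map (b *ᶻ_) (a ∷ p)) (suc n) +ᶻ coeff ((a ∷ p) *ₚ q) n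
      ≡⟨ sym (coeff-+ₚ (map (b *ᶻ_) (a ∷ p)) (+ 0 ∷ ((a ∷ p) *ₚ q)) (suc n)) ⟩
    coeff (map (b *ᶻ_) (a ∷ p) +ₚ (+ 0 ∷ ((a ∷ p) *ₚ q))) (suc n)
      ∎
    where
    exchange : ∀ u v w → u +ᶻ (v +ᶻ w) ≡ v +ᶻ (u +ᶻ w)
    exchange = solve-∀

  *ₚ-comm : ∀ p q → (p *ₚ q) ≈ₚ (q *ₚ p)
  *ₚ-comm []      q n = sym (*ₚ-zeroʳ q n)
  *ₚ-comm (a ∷ p) q n = begin
    coeff ((a ∷ p) *ₚ q) n                          ≡⟨ coeff-+ₚ (map (a *ᶻ_) q) (+ 0 ∷ (p *ₚ q)) n ⟩
    coeff (map (a *ᶻ_) q) n +ᶻ coeff (+ 0 ∷ (p *ₚ q)) n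
      ≡⟨ cong (coeff (map (a *ᶻ_) q) n +ᶻ_) (∷-cong (+ 0) (*ₚ-comm p q) n) ⟩
    coeff (map (a *ᶻ_) q) n +ᶻ coeff (+ 0 ∷ (q *ₚ p)) n ≡⟨ sym (coeff-+ₚ (map (a *ᶻ_) q) (+ 0 ∷ (q *ₚ p)) n) ⟩
    coeff (map (a *ᶻ_) q +ₚ (+ 0 ∷ (q *ₚ p))) n     ≡⟨ sym (*ₚ-∷ q a p n) ⟩
    coeff (q *ₚ (a ∷ p)) n                          ∎

  *ₚ-distribʳ : ∀ p q r → ((q +ₚ r) *ₚ p) ≈ₚ ((q *ₚ p) +ₚ (r *ₚ p))
  *ₚ-distribʳ p q r n = begin
    coeff ((q +ₚ r) *ₚ p) n            ≡⟨ *ₚ-comm (q +ₚ r) p n ⟩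
    coeff (p *ₚ (q +ₚ r)) n            ≡⟨ *ₚ-distribˡ p q r n ⟩
    coeff ((p *ₚ q) +ₚ (p *ₚ r)) n     ≡⟨ +ₚ-cong {p *ₚ q} {q *ₚ p} {p *ₚ r} {r *ₚ p} (*ₚ-comm p q) (*ₚ-comm p r) n ⟩
    coeff ((q *ₚ p) +ₚ (r *ₚ p)) n     ∎

  coeff-0∷-map-* : ∀ a p n → coeff (+ 0 ∷ map (a *ᶻ_) p) n ≡ a *ᶻ coeff (+ 0 ∷ p) n
  coeff-0∷-map-* a p zero    = sym (ℤ.*-zeroʳ a)
  coeff-0∷-map-* a p (suc n) = coeff-map-* a p n

  map-*-*ₚ : ∀ a q r → (map (a *ᶻ_) q *ₚ r) ≈ₚ map (a *ᶻ_) (q *ₚ r)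
  map-*-*ₚ a []      r n = refl
  map-*-*ₚ a (b ∷ q) r n = begin
    coeff ((a *ᶻ b ∷ map (a *ᶻ_) q) *ₚ r) n
      ≡⟨ coeff-∷-*ₚ (a *ᶻ b) (map (a *ᶻ_) q) r n ⟩
    a *ᶻ b *ᶻ coeff r n +ᶻ coeff (+ 0 ∷ (map (a *ᶻ_) q *ₚ r)) n
      ≡⟨ cong (a *ᶻ b *ᶻ coeff r n +ᶻ_) (∷-cong (+ 0) (map-*-*ₚ a q r) n) ⟩
    a *ᶻ b *ᶻ coeff r n +ᶻ coeff (+ 0 ∷ map (a *ᶻ_) (q *ₚ r)) n
      ≡⟨ cong (a *ᶻ b *ᶻ coeff r n +ᶻ_) (coeff-0∷-map-* a (q *ₚ r) n) ⟩
    a *ᶻ b *ᶻ coeff r n +ᶻ a *ᶻ coeff (+ 0 ∷ (q *ₚ r)) n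
      ≡⟨ factor a b (coeff r n) _ ⟩
    a *ᶻ (b *ᶻ coeff r n +ᶻ coeff (+ 0 ∷ (q *ₚ r)) n)
      ≡⟨ cong (a *ᶻ_) (sym (coeff-∷-*ₚ b q r n)) ⟩
    a *ᶻ coeff ((b ∷ q) *ₚ r) n
      ≡⟨ sym (coeff-map-* a ((b ∷ q) *ₚ r) n) ⟩
    coeff (map (a *ᶻ_) ((b ∷ q) *ₚ r)) n
      ∎
    where
    factor : ∀ a b c d → a *ᶻ b *ᶻ c +ᶻ a *ᶻ d ≡ a *ᶻ (b *ᶻ c +ᶻ d)
    factor = solve-∀

  0∷-*ₚ : ∀ p r → ((+ 0 ∷ p) *ₚ r) ≈ₚ (+ 0 ∷ (p *ₚ r))
  0∷-*ₚ p r n = begin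
    coeff ((+ 0 ∷ p) *ₚ r) n                        ≡⟨ coeff-∷-*ₚ (+ 0) p r n ⟩
    + 0 *ᶻ coeff r n +ᶻ coeff (+ 0 ∷ (p *ₚ r)) n    ≡⟨ cong (_+ᶻ coeff (+ 0 ∷ (p *ₚ r)) n) (ℤ.*-zeroˡ (coeff r n)) ⟩
    + 0 +ᶻ coeff (+ 0 ∷ (p *ₚ r)) n                 ≡⟨ ℤ.+-identityˡ _ ⟩
    coeff (+ 0 ∷ (p *ₚ r)) n                        ∎

  *ₚ-assoc : ∀ p q r → ((p *ₚ q) *ₚ r) ≈ₚ (p *ₚ (q *ₚ r))
  *ₚ-assoc []      q r n = refl
  *ₚ-assoc (a ∷ p) q r n = begin
    coeff ((map (a *ᶻ_) q +ₚ (+ 0 ∷ (p *ₚ q))) *ₚ r) n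
      ≡⟨ *ₚ-distribʳ r (map (a *ᶻ_) q) (+ 0 ∷ (p *ₚ q)) n ⟩
    coeff ((map (a *ᶻ_) q *ₚ r) +ₚ ((+ 0 ∷ (p *ₚ q)) *ₚ r)) n
      ≡⟨ +ₚ-cong {map (a *ᶻ_) q *ₚ r} {map (a *ᶻ_) (q *ₚ r)} {(+ 0 ∷ (p *ₚ q)) *ₚ r} {+ 0 ∷ (p *ₚ (q *ₚ r))}
           (map-*-*ₚ a q r) (λ m → trans (0∷-*ₚ (p *ₚ q) r m) (∷-cong (+ 0) (*ₚ-assoc p q r) m)) n ⟩
    coeff (map (a *ᶻ_) (q *ₚ r) +ₚ (+ 0 ∷ (p *ₚ (q *ₚ r)))) n
      ∎

  -- p ≈ₚ q unfolds to a function type from which p and q cannot be inferred; the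
  -- record wrapper makes them inferable, as the ring bundle and the solver need.
  record _≋_ (p q : Poly) : Set where
    constructor mk≋
    field coeffwise : p ≈ₚ q
  open _≋_ public

  ℤ[X] : CommutativeRing _ _
  ℤ[X] = record
    { Carrier = Poly ; _≈_ = _≋_ ; _+_ = _+ₚ_ ; _*_ = _*ₚ_ ; -_ = -ₚ_ ; 0# = [] ; 1# = 1ₚ
    ; isCommutativeRing = record
      { isRing = record
        { +-isAbelianGroup = record
          { isGroup = record
            { isMonoid = record
              { isSemigroup = record
                { isMagma = record
                  { isEquivalence = record
                    { refl  = mk≋ (λ n → refl)
                    ; sym   = λ p≋q → mk≋ (λ n → sym (coeffwise p≋q n))
                    ; trans = λ p≋q q≋r → mk≋ (λ n → trans (coeffwise p≋q n) (coeffwise q≋r n))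
                    }
                  ; ∙-cong = λ {p} {p'} {q} {q'} p≋p' q≋q' →
                      mk≋ (+ₚ-cong {p} {p'} {q} {q'} (coeffwise p≋p') (coeffwise q≋q'))
                  }
                ; assoc = λ p q r → mk≋ (+ₚ-assoc p q r)
                }
              ; identity = (λ p → mk≋ (λ n → refl)) , (λ p → mk≋ (+ₚ-identityʳ p))
              }
            ; inverse = (λ p → mk≋ (-ₚ-inverseˡ p)) , (λ p → mk≋ (-ₚ-inverseʳ p))
            ; ⁻¹-cong = λ {p} {p'} p≋p' → mk≋ (-ₚ-cong {p} {p'} (coeffwise p≋p'))
            }
          ; comm = λ p q → mk≋ (+ₚ-comm p q)
          }
        ; *-cong = λ {p} {p'} {q} {q'} p≋p' q≋q' →
            mk≋ (λ n → trans (*ₚ-congʳ {p} {p'} q (coeffwise p≋p') n) (*ₚ-congˡ p' {q} {q'} (coeffwise q≋q') n))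
        ; *-assoc = λ p q r → mk≋ (*ₚ-assoc p q r)
        ; *-identity = (λ p → mk≋ (*ₚ-identityˡ p)) , (λ p → mk≋ (λ n → trans (*ₚ-comm p 1ₚ n) (*ₚ-identityˡ p n)))
        ; distrib = (λ p q r → mk≋ (*ₚ-distribˡ p q r)) , (λ p q r → mk≋ (*ₚ-distribʳ p q r))
        }
      ; *-comm = λ p q → mk≋ (*ₚ-comm p q)
      }
    }

  ∣ₚ-resp-≈ₚ : ∀ {p p' q q'} → p ≈ₚ p' → q ≈ₚ q' → p ∣ₚ q → p' ∣ₚ q'
  ∣ₚ-resp-≈ₚ {p} {p'} p≈p' q≈q' (r , pr≈q) =
    r , λ n → trans (sym (*ₚ-congʳ {p} {p'} r p≈p' n)) (trans (pr≈q n) (q≈q' n))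

  constant : ℤ → Poly
  constant a = a ∷ []

  constant-homomorphism : +-*-rawRing -Raw-AlmostCommutative⟶ fromCommutativeRing ℤ[X]
  constant-homomorphism = record
    { ⟦_⟧    = constant
    ; +-homo = λ a b → mk≋ λ { zero → refl ; (suc n) → refl }
    ; *-homo = λ a b → mk≋ λ { zero → sym (ℤ.+-identityʳ _) ; (suc n) → refl }
    ; -‿homo = λ a → mk≋ λ { zero → refl ; (suc n) → refl }
    ; 0-homo = mk≋ λ { zero → refl ; (suc n) → refl }
    ; 1-homo = mk≋ λ { zero → refl ; (suc n) → refl }
    }

  constant-≟ : ∀ a b → Maybe (constant a ≋ constant b)
  constant-≟ a b with a ≟ᶻ b
  ... | yes refl = just (mk≋ λ n → refl)
  ... | no _     = nothing

module LucasPolynomials where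

  open IntegerPolynomials
  open import Algebra.Bundles using (CommutativeRing; Semiring)
  open import Algebra.Solver.Ring.AlmostCommutativeRing using (fromCommutativeRing)
  open import Data.Integer using (+_; +-*-rawRing)
  open import Data.Nat as ℕ using (ℕ; zero; suc)
  import Data.Nat.Properties as ℕ
  open import Data.Nat.Tactic.RingSolver using () renaming (solve-∀ to solve-∀ℕ)
  open import Data.Product using (_×_; _,_; proj₁; proj₂)
  open import Relation.Binary.PropositionalEquality using (_≡_)
  import Relation.Binary.PropositionalEquality as ≡

  open import Algebra.Solver.Ring +-*-rawRing (fromCommutativeRing ℤ[X]) constant-homomorphism constant-≟
  open CommutativeRing ℤ[X] using (_≈_; _+_; _*_; -_; _-_; 1#; setoid; refl; sym; +-cong; *-cong; -‿cong; *-identityʳ; semiring)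
  open import Algebra.Definitions.RawSemiring (Semiring.rawSemiring semiring) using (_^_)
  open import Relation.Binary.Reasoning.Setoid setoid

  lucas : ℕ → Poly
  lucas zero          = constant (+ 2)
  lucas (suc zero)    = 1#
  lucas (suc (suc n)) = lucas (suc n) + X * lucas n

  -- The index m + k * 2 (rather than 2 * k) reduces along the recursion of lucas.
  LucasAddition : ℕ → ℕ → Set
  LucasAddition m k = lucas (m ℕ.+ k ℕ.* 2) + (- X) ^ k * lucas m ≈ lucas (m ℕ.+ k) * lucas k

  lucas-square-and-product-step : ∀ j → LucasAddition 0 j × LucasAddition 1 j → LucasAddition 1 (suc j) →
                                  LucasAddition 0 (suc (suc j)) × LucasAddition 1 (suc (suc j))
  lucas-square-and-product-step j (A² , BA) CB = square , product
    where
    A = lucas j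
    B = lucas (suc j)
    P = lucas (j ℕ.* 2)
    Q = lucas (suc (j ℕ.* 2))
    w = (- X) ^ j
    two = constant (+ 2)
    square : Q + X * P + X * Q + X * (Q + X * P) + (- X) * ((- X) * w) * two ≈ (B + X * A) * (B + X * A)
    square = begin
      Q + X * P + X * Q + X * (Q + X * P) + (- X) * ((- X) * w) * two
        ≈⟨ solve 4 (λ x P Q w → Q :+ x :* P :+ x :* Q :+ x :* (Q :+ x :* P) :+ (:- x) :* ((:- x) :* w) :* con (+ 2)
                               := Q :+ x :* P :+ x :* Q :+ (:- x) :* w :* con (+ 1)
                                  :+ x :* (Q :+ w :* con (+ 1)) :+ x :* x :* (P :+ w :* con (+ 2)))
                   refl X P Q w ⟩
      Q + X * P + X * Q + (- X) * w * 1# + X * (Q + w * 1#) + X * X * (P + w * two)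
        ≈⟨ +-cong (+-cong CB (*-cong (refl {X}) BA)) (*-cong (refl {X * X}) A²) ⟩
      (B + X * A) * B + X * (B * A) + X * X * (A * A)
        ≈⟨ solve 3 (λ x A B → (B :+ x :* A) :* B :+ x :* (B :* A) :+ x :* x :* (A :* A)
                             := (B :+ x :* A) :* (B :+ x :* A)) refl X A B ⟩
      (B + X * A) * (B + X * A)
        ∎
    product : Q + X * P + X * Q + X * (Q + X * P) + X * (Q + X * P + X * Q) + (- X) * ((- X) * w) * 1#
              ≈ (B + X * A + X * B) * (B + X * A)
    product = begin
      Q + X * P + X * Q + X * (Q + X * P) + X * (Q + X * P + X * Q) + (- X) * ((- X) * w) * 1#
        ≈⟨ solve 4 (λ x P Q w → Q :+ x :* P :+ x :* Q :+ x :* (Q :+ x :* P) :+ x :* (Q :+ x :* P :+ x :* Q)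
                                   :+ (:- x) :* ((:- x) :* w) :* con (+ 1)
                               := Q :+ x :* P :+ x :* Q :+ x :* (Q :+ x :* P) :+ (:- x) :* ((:- x) :* w) :* con (+ 2)
                                   :+ x :* (Q :+ x :* P :+ x :* Q :+ (:- x) :* w :* con (+ 1)))
                   refl X P Q w ⟩
      Q + X * P + X * Q + X * (Q + X * P) + (- X) * ((- X) * w) * two + X * (Q + X * P + X * Q + (- X) * w * 1#)
        ≈⟨ +-cong square (*-cong (refl {X}) CB) ⟩
      (B + X * A) * (B + X * A) + X * ((B + X * A) * B)
        ≈⟨ solve 3 (λ x A B → (B :+ x :* A) :* (B :+ x :* A) :+ x :* ((B :+ x :* A) :* B)
                             := (B :+ x :* A :+ x :* B) :* (B :+ x :* A)) refl X A B ⟩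
      (B + X * A + X * B) * (B + X * A)
        ∎

  lucas-square-and-product : ∀ k → LucasAddition 0 k × LucasAddition 1 k
  lucas-square-and-product zero =
      solve 0 (con (+ 2) :+ con (+ 1) :* con (+ 2) := con (+ 2) :* con (+ 2)) refl
    , solve 0 (con (+ 1) :+ con (+ 1) :* con (+ 1) := con (+ 1) :* con (+ 2)) refl
  lucas-square-and-product (suc zero) =
      solve 1 (λ x → con (+ 1) :+ x :* con (+ 2) :+ (:- x) :* con (+ 1) :* con (+ 2) := con (+ 1) :* con (+ 1)) refl X
    , solve 1 (λ x → con (+ 1) :+ x :* con (+ 2) :+ x :* con (+ 1) :+ (:- x) :* con (+ 1) :* con (+ 1)
                     := (con (+ 1) :+ x :* con (+ 2)) :* con (+ 1)) refl X
  lucas-square-and-product (suc (suc j)) =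
    lucas-square-and-product-step j (lucas-square-and-product j) (proj₂ (lucas-square-and-product (suc j)))

  lucas-addition : ∀ m k → LucasAddition m k
  lucas-addition zero          k = proj₁ (lucas-square-and-product k)
  lucas-addition (suc zero)    k = proj₂ (lucas-square-and-product k)
  lucas-addition (suc (suc m)) k = begin
    lucas (suc (m ℕ.+ k ℕ.* 2)) + X * lucas (m ℕ.+ k ℕ.* 2) + σ * (lucas (suc m) + X * lucas m)
      ≈⟨ solve 6 (λ x σ a b c d → a :+ x :* b :+ σ :* (c :+ x :* d) := a :+ σ :* c :+ x :* (b :+ σ :* d))
                 refl X σ (lucas (suc (m ℕ.+ k ℕ.* 2))) (lucas (m ℕ.+ k ℕ.* 2)) (lucas (suc m)) (lucas m) ⟩
    lucas (suc m ℕ.+ k ℕ.* 2) + σ * lucas (suc m) + X * (lucas (m ℕ.+ k ℕ.* 2) + σ * lucas m)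
      ≈⟨ +-cong (lucas-addition (suc m) k) (*-cong (refl {X}) (lucas-addition m k)) ⟩
    lucas (suc m ℕ.+ k) * lucas k + X * (lucas (m ℕ.+ k) * lucas k)
      ≈⟨ solve 4 (λ x a b c → a :* c :+ x :* (b :* c) := (a :+ x :* b) :* c)
                 refl X (lucas (suc m ℕ.+ k)) (lucas (m ℕ.+ k)) (lucas k) ⟩
    (lucas (suc m ℕ.+ k) + X * lucas (m ℕ.+ k)) * lucas k
      ∎
    where σ = (- X) ^ k

  lucas∣ₚlucas⇒lucas∣ₚlucas-+-double : ∀ k m → lucas k ∣ₚ lucas m → lucas k ∣ₚ lucas (m ℕ.+ k ℕ.* 2)
  lucas∣ₚlucas⇒lucas∣ₚlucas-+-double k m (q , Lₖq≈Lₘ) = lucas (m ℕ.+ k) - σ * q , coeffwise (begin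
    lucas k * (lucas (m ℕ.+ k) - σ * q)
      ≈⟨ solve 4 (λ l a σ q → l :* (a :- σ :* q) := a :* l :- σ :* (l :* q)) refl (lucas k) (lucas (m ℕ.+ k)) σ q ⟩
    lucas (m ℕ.+ k) * lucas k - σ * (lucas k * q)
      ≈⟨ +-cong (sym (lucas-addition m k)) (-‿cong (*-cong (refl {σ}) (mk≋ Lₖq≈Lₘ))) ⟩
    lucas (m ℕ.+ k ℕ.* 2) + σ * lucas m - σ * lucas m
      ≈⟨ solve 2 (λ a b → a :+ b :- b := a) refl (lucas (m ℕ.+ k ℕ.* 2)) (σ * lucas m) ⟩
    lucas (m ℕ.+ k ℕ.* 2)
      ∎)
    where σ = (- X) ^ k

  lucas∣ₚlucas-odd-multiple : ∀ k t → lucas k ∣ₚ lucas (suc (t ℕ.* 2) ℕ.* k)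
  lucas∣ₚlucas-odd-multiple k zero    =
    ≡.subst (λ n → lucas k ∣ₚ lucas n) (≡.sym (ℕ.+-identityʳ k)) (1# , coeffwise (*-identityʳ (lucas k)))
  lucas∣ₚlucas-odd-multiple k (suc t) = ≡.subst (λ n → lucas k ∣ₚ lucas n) (index t k)
    (lucas∣ₚlucas⇒lucas∣ₚlucas-+-double k (suc (t ℕ.* 2) ℕ.* k) (lucas∣ₚlucas-odd-multiple k t))
    where
    index : ∀ t k → suc (t ℕ.* 2) ℕ.* k ℕ.+ k ℕ.* 2 ≡ suc (suc t ℕ.* 2) ℕ.* k
    index = solve-∀ℕ

module LucasNumbers where

  open IntegerPolynomials using (X; -ₚ_; ℤ[X]; coeffwise)
  open LucasPolynomials using (lucas; lucas-addition)
  open import Algebra.Bundles using (CommutativeRing; Semiring)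
  open import Algebra.Definitions.RawSemiring (Semiring.rawSemiring (CommutativeRing.semiring ℤ[X])) using (_^_)
  open import Data.Integer using (ℤ; +_; -[1+_]; ∣_∣) renaming (_+_ to _+ᶻ_; _*_ to _*ᶻ_)
  import Data.Integer.Properties as ℤ
  open import Data.Integer.Divisibility.Signed as ℤ∣ using (∣ᵤ⇒∣; ∣⇒∣ᵤ)
  open import Data.Integer.Tactic.RingSolver using (solve-∀)
  open import Data.List using ([]; _∷_; map)
  open import Data.Nat as ℕ using (ℕ; zero; suc; _+_; _*_; _<_; _≤_; z≤n; s≤s)
  import Data.Nat.Properties as ℕ
  open import Data.Nat.Divisibility using (_∣_; ∣⇒≤; ∣-refl; ∣-reflexive; ∣m∣n⇒∣m+n; m∣m*n; n∣m*n)
  open import Data.Nat.Induction using (<-rec)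
  open import Data.Nat.Tactic.RingSolver using () renaming (solve-∀ to solve-∀ℕ)
  open import Data.Product using (_,_)
  open import Data.Sum using (inj₁; inj₂)
  open import Relation.Binary.Definitions using (tri<; tri≈; tri>)
  open import Relation.Nullary using (¬_; contradiction)
  open import Relation.Binary.PropositionalEquality
    using (_≡_; refl; sym; trans; cong; cong₂; subst; module ≡-Reasoning)
  open ≡-Reasoning

  eval₁ : Poly → ℤ
  eval₁ []      = + 0
  eval₁ (a ∷ p) = a +ᶻ eval₁ p

  eval₁-+ₚ : ∀ p q → eval₁ (p +ₚ q) ≡ eval₁ p +ᶻ eval₁ q
  eval₁-+ₚ []      q       = sym (ℤ.+-identityˡ _)
  eval₁-+ₚ (a ∷ p) []      = sym (ℤ.+-identityʳ _)
  eval₁-+ₚ (a ∷ p) (b ∷ q) = trans (cong (a +ᶻ b +ᶻ_) (eval₁-+ₚ p q)) (interchange a b (eval₁ p) (eval₁ q))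
    where
    interchange : ∀ a b c d → a +ᶻ b +ᶻ (c +ᶻ d) ≡ a +ᶻ c +ᶻ (b +ᶻ d)
    interchange = solve-∀

  eval₁-map-* : ∀ a q → eval₁ (map (a *ᶻ_) q) ≡ a *ᶻ eval₁ q
  eval₁-map-* a []      = sym (ℤ.*-zeroʳ a)
  eval₁-map-* a (b ∷ q) = trans (cong (a *ᶻ b +ᶻ_) (eval₁-map-* a q)) (sym (ℤ.*-distribˡ-+ a b (eval₁ q)))

  eval₁-*ₚ : ∀ p q → eval₁ (p *ₚ q) ≡ eval₁ p *ᶻ eval₁ q
  eval₁-*ₚ []      q = sym (ℤ.*-zeroˡ (eval₁ q))
  eval₁-*ₚ (a ∷ p) q = begin
    eval₁ (map (a *ᶻ_) q +ₚ (+ 0 ∷ (p *ₚ q)))        ≡⟨ eval₁-+ₚ (map (a *ᶻ_) q) (+ 0 ∷ (p *ₚ q)) ⟩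
    eval₁ (map (a *ᶻ_) q) +ᶻ (+ 0 +ᶻ eval₁ (p *ₚ q)) ≡⟨ cong₂ _+ᶻ_ (eval₁-map-* a q)
                                                         (trans (ℤ.+-identityˡ _) (eval₁-*ₚ p q)) ⟩
    a *ᶻ eval₁ q +ᶻ eval₁ p *ᶻ eval₁ q            ≡⟨ sym (ℤ.*-distribʳ-+ (eval₁ q) a (eval₁ p)) ⟩
    (a +ᶻ eval₁ p) *ᶻ eval₁ q                      ∎

  eval₁-≈ₚ-zero : ∀ p → p ≈ₚ [] → eval₁ p ≡ + 0
  eval₁-≈ₚ-zero []      p≈0 = refl
  eval₁-≈ₚ-zero (a ∷ p) p≈0 = cong₂ _+ᶻ_ (p≈0 zero) (eval₁-≈ₚ-zero p (λ n → p≈0 (suc n)))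

  eval₁-cong : ∀ p q → p ≈ₚ q → eval₁ p ≡ eval₁ q
  eval₁-cong []      q       p≈q = sym (eval₁-≈ₚ-zero q (λ n → sym (p≈q n)))
  eval₁-cong (a ∷ p) []      p≈q = eval₁-≈ₚ-zero (a ∷ p) p≈q
  eval₁-cong (a ∷ p) (b ∷ q) p≈q = cong₂ _+ᶻ_ (p≈q zero) (eval₁-cong p q (λ n → p≈q (suc n)))

  lucasNumber : ℕ → ℕ
  lucasNumber zero          = 2
  lucasNumber (suc zero)    = 1
  lucasNumber (suc (suc n)) = lucasNumber (suc n) + lucasNumber n

  eval₁-lucas : ∀ n → eval₁ (lucas n) ≡ + lucasNumber n
  eval₁-lucas zero          = refl
  eval₁-lucas (suc zero)    = refl
  eval₁-lucas (suc (suc n)) = begin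
    eval₁ (lucas (suc n) +ₚ (X *ₚ lucas n))          ≡⟨ eval₁-+ₚ (lucas (suc n)) (X *ₚ lucas n) ⟩
    eval₁ (lucas (suc n)) +ᶻ eval₁ (X *ₚ lucas n)   ≡⟨ cong₂ _+ᶻ_ (eval₁-lucas (suc n))
                                                         (trans (eval₁-*ₚ X (lucas n)) (trans (ℤ.*-identityˡ _) (eval₁-lucas n))) ⟩
    + lucasNumber (suc n) +ᶻ + lucasNumber n        ≡⟨ sym (ℤ.pos-+ (lucasNumber (suc n)) (lucasNumber n)) ⟩
    + lucasNumber (suc (suc n))                      ∎

  ∣eval₁[-X^k]∣≡1 : ∀ k → ∣ eval₁ ((-ₚ X) ^ k) ∣ ≡ 1
  ∣eval₁[-X^k]∣≡1 zero    = refl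
  ∣eval₁[-X^k]∣≡1 (suc k) = begin
    ∣ eval₁ ((-ₚ X) *ₚ ((-ₚ X) ^ k)) ∣       ≡⟨ cong ∣_∣ (eval₁-*ₚ (-ₚ X) ((-ₚ X) ^ k)) ⟩
    ∣ -[1+ 0 ] *ᶻ eval₁ ((-ₚ X) ^ k) ∣     ≡⟨ ℤ.abs-* -[1+ 0 ] (eval₁ ((-ₚ X) ^ k)) ⟩
    1 * ∣ eval₁ ((-ₚ X) ^ k) ∣              ≡⟨ trans (ℕ.*-identityˡ _) (∣eval₁[-X^k]∣≡1 k) ⟩
    1                                       ∎

  lucasNumber-addition : ∀ m k →
    + lucasNumber (m + k * 2) +ᶻ eval₁ ((-ₚ X) ^ k) *ᶻ + lucasNumber m ≡ + lucasNumber (m + k) *ᶻ + lucasNumber k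
  lucasNumber-addition m k = begin
    + lucasNumber (m + k * 2) +ᶻ σ *ᶻ + lucasNumber m
      ≡⟨ sym (cong₂ (λ a b → a +ᶻ σ *ᶻ b) (eval₁-lucas (m + k * 2)) (eval₁-lucas m)) ⟩
    eval₁ (lucas (m + k * 2)) +ᶻ σ *ᶻ eval₁ (lucas m)
      ≡⟨ sym (trans (eval₁-+ₚ (lucas (m + k * 2)) (((-ₚ X) ^ k) *ₚ lucas m))
                    (cong (eval₁ (lucas (m + k * 2)) +ᶻ_) (eval₁-*ₚ ((-ₚ X) ^ k) (lucas m)))) ⟩
    eval₁ (lucas (m + k * 2) +ₚ (((-ₚ X) ^ k) *ₚ lucas m))
      ≡⟨ eval₁-cong (lucas (m + k * 2) +ₚ (((-ₚ X) ^ k) *ₚ lucas m)) (lucas (m + k) *ₚ lucas k)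
                    (coeffwise (lucas-addition m k)) ⟩
    eval₁ (lucas (m + k) *ₚ lucas k)
      ≡⟨ trans (eval₁-*ₚ (lucas (m + k)) (lucas k)) (cong₂ _*ᶻ_ (eval₁-lucas (m + k)) (eval₁-lucas k)) ⟩
    + lucasNumber (m + k) *ᶻ + lucasNumber k
      ∎
    where σ = eval₁ ((-ₚ X) ^ k)

  ∣lucasNumber-descent : ∀ {d} m r →
    d ∣ lucasNumber (m + r) * lucasNumber r → d ∣ lucasNumber (m + r * 2) → d ∣ lucasNumber m
  ∣lucasNumber-descent {d} m r d∣product d∣sum = subst (d ∣_) ∣σLₘ∣≡Lₘ (∣⇒∣ᵤ d∣σLₘ)
    where
    σ = eval₁ ((-ₚ X) ^ r)
    d∣σLₘ : + d ℤ∣.∣ σ *ᶻ + lucasNumber m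
    d∣σLₘ = ℤ∣.∣m+n∣m⇒∣n
      (subst (+ d ℤ∣.∣_) (sym (lucasNumber-addition m r))
        (subst (+ d ℤ∣.∣_) (ℤ.pos-* (lucasNumber (m + r)) (lucasNumber r))
          (∣ᵤ⇒∣ {+ d} {+ (lucasNumber (m + r) * lucasNumber r)} d∣product)))
      (∣ᵤ⇒∣ {+ d} {+ lucasNumber (m + r * 2)} d∣sum)
    ∣σLₘ∣≡Lₘ : ∣ σ *ᶻ + lucasNumber m ∣ ≡ lucasNumber m
    ∣σLₘ∣≡Lₘ = begin
      ∣ σ *ᶻ + lucasNumber m ∣   ≡⟨ ℤ.abs-* σ (+ lucasNumber m) ⟩
      ∣ σ ∣ * lucasNumber m      ≡⟨ cong (_* lucasNumber m) (∣eval₁[-X^k]∣≡1 r) ⟩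
      1 * lucasNumber m          ≡⟨ ℕ.*-identityˡ (lucasNumber m) ⟩
      lucasNumber m              ∎

  lucasNumber-positive : ∀ n → 0 < lucasNumber n
  lucasNumber-positive zero          = s≤s z≤n
  lucasNumber-positive (suc zero)    = s≤s z≤n
  lucasNumber-positive (suc (suc n)) = ℕ.<-≤-trans (lucasNumber-positive (suc n)) (ℕ.m≤m+n _ _)

  2<lucasNumber : ∀ n → 2 < lucasNumber (suc (suc n))
  2<lucasNumber zero    = s≤s (s≤s (s≤s z≤n))
  2<lucasNumber (suc n) = ℕ.<-≤-trans (2<lucasNumber n) (ℕ.m≤m+n _ _)

  lucasNumber-strictMono : ∀ {m n} → m < n → lucasNumber (suc m) < lucasNumber (suc n)
  lucasNumber-strictMono {m} {suc n} m<1+n with ℕ.m<1+n⇒m<n∨m≡n m<1+n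
  ... | inj₁ m<n  = ℕ.<-trans (lucasNumber-strictMono m<n) (ℕ.m<m+n _ (lucasNumber-positive n))
  ... | inj₂ refl = ℕ.m<m+n _ (lucasNumber-positive n)

  lucasNumber-< : ∀ {m n} → 2 ≤ n → m < n → lucasNumber m < lucasNumber n
  lucasNumber-< {zero}  {suc (suc n)} _ _         = 2<lucasNumber n
  lucasNumber-< {zero}  {suc zero}    (s≤s ()) _
  lucasNumber-< {suc m} {suc n}       _ (s≤s m<n) = lucasNumber-strictMono m<n

  lucasNumber∤-below : ∀ {k m} → 2 ≤ k → m < k → ¬ lucasNumber k ∣ lucasNumber m
  lucasNumber∤-below {k} {m} 2≤k m<k Lₖ∣Lₘ =
    ℕ.<⇒≱ (lucasNumber-< 2≤k m<k) (∣⇒≤ {{ℕ.>-nonZero (lucasNumber-positive m)}} Lₖ∣Lₘ)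

  lucasNumber∤-between : ∀ {k r} → 2 ≤ k → 0 < r → r < k → ¬ lucasNumber k ∣ lucasNumber (k + r)
  lucasNumber∤-between {k} {r} 2≤k 0<r r<k Lₖ∣Lₖ₊ᵣ with ℕ.m≤n⇒∃[o]m+o≡n (ℕ.<⇒≤ r<k)
  ... | m , refl = lucasNumber∤-below 2≤k (ℕ.m<n+m m 0<r) (∣lucasNumber-descent m r Lₖ∣product Lₖ∣sum)
    where
    Lₖ∣product : lucasNumber (r + m) ∣ lucasNumber (m + r) * lucasNumber r
    Lₖ∣product = subst (λ i → lucasNumber (r + m) ∣ lucasNumber i * lucasNumber r) (ℕ.+-comm r m) (m∣m*n _)
    Lₖ∣sum : lucasNumber (r + m) ∣ lucasNumber (m + r * 2)
    Lₖ∣sum = subst (λ i → lucasNumber (r + m) ∣ lucasNumber i) (index r m) Lₖ∣Lₖ₊ᵣ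
      where
      index : ∀ r m → r + m + r ≡ m + r * 2
      index = solve-∀ℕ

  lucasNumber∣⇒∣ : ∀ {k} → 2 ≤ k → ∀ s → lucasNumber k ∣ lucasNumber s → k ∣ s
  lucasNumber∣⇒∣ {k} 2≤k = <-rec (λ s → lucasNumber k ∣ lucasNumber s → k ∣ s) step
    where
    step : ∀ s → (∀ {m} → m < s → lucasNumber k ∣ lucasNumber m → k ∣ m) → lucasNumber k ∣ lucasNumber s → k ∣ s
    step s rec Lₖ∣Lₛ with ℕ.<-cmp s k
    ... | tri< s<k _ _ = contradiction Lₖ∣Lₛ (lucasNumber∤-below 2≤k s<k)
    ... | tri≈ _ s≡k _ = ∣-reflexive (sym s≡k)
    ... | tri> _ _ k<s with ℕ.m≤n⇒∃[o]m+o≡n (ℕ.<⇒≤ k<s)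
    ...   | r , refl with ℕ.<-cmp r k
    ...     | tri< r<k _ _ = contradiction Lₖ∣Lₛ (lucasNumber∤-between 2≤k 0<r r<k)
      where
      0<r : 0 < r
      0<r = ℕ.n≢0⇒n>0 (λ { refl → ℕ.<-irrefl (sym (ℕ.+-identityʳ k)) k<s })
    ...     | tri≈ _ refl _ = ∣m∣n⇒∣m+n ∣-refl ∣-refl
    ...     | tri> _ _ k<r with ℕ.m≤n⇒∃[o]m+o≡n (ℕ.<⇒≤ k<r)
    ...       | m , refl = ∣m∣n⇒∣m+n ∣-refl (∣m∣n⇒∣m+n ∣-refl (rec m<s Lₖ∣Lₘ))
      where
      m<s : m < k + (k + m)
      m<s = ℕ.<-≤-trans (ℕ.m<n+m m (ℕ.<-≤-trans (s≤s z≤n) 2≤k)) (ℕ.m≤n+m (k + m) k)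
      Lₖ∣Lₘ : lucasNumber k ∣ lucasNumber m
      Lₖ∣Lₘ = ∣lucasNumber-descent m k (n∣m*n (lucasNumber (m + k)))
        (subst (λ i → lucasNumber k ∣ lucasNumber i) (index k m) Lₖ∣Lₛ)
        where
        index : ∀ k m → k + (k + m) ≡ m + k * 2
        index = solve-∀ℕ

  lucas∣ₚlucas⇒lucasNumber∣lucasNumber : ∀ k n → lucas k ∣ₚ lucas n → lucasNumber k ∣ lucasNumber n
  lucas∣ₚlucas⇒lucasNumber∣lucasNumber k n (r , Lₖr≈Lₙ) = ∣⇒∣ᵤ (ℤ∣.divides (eval₁ r) (begin
    + lucasNumber n                    ≡⟨ sym (eval₁-lucas n) ⟩
    eval₁ (lucas n)                    ≡⟨ sym (eval₁-cong (lucas k *ₚ r) (lucas n) Lₖr≈Lₙ) ⟩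
    eval₁ (lucas k *ₚ r)               ≡⟨ eval₁-*ₚ (lucas k) r ⟩
    eval₁ (lucas k) *ᶻ eval₁ r         ≡⟨ cong (_*ᶻ eval₁ r) (eval₁-lucas k) ⟩
    + lucasNumber k *ᶻ eval₁ r         ≡⟨ ℤ.*-comm (+ lucasNumber k) (eval₁ r) ⟩
    eval₁ r *ᶻ + lucasNumber k         ∎))

module SubsetCounting where

  open import Data.Bool using (Bool; true; false; _∧_; if_then_else_)
  open import Data.Bool.Properties using (T?; ∧-zeroʳ)
  open import Data.Fin.Subset using (Subset; ∣_∣)
  open import Data.List using (List; []; _∷_; _++_; map; filter; length)
  open import Data.Fin.Subset.Properties using (∣p∣≤n)
  open import Data.Nat using (ℕ; zero; suc; _+_; _<_; _≡ᵇ_)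
  import Data.Nat.Properties as ℕ
  open import Data.Vec using (_∷_)
  open import Function using (_∘_)
  open import Relation.Nullary.Decidable using (dec-false)
  open import Relation.Binary.PropositionalEquality using (_≡_; refl; trans; cong; cong₂)

  count : {A : Set} → (A → Bool) → List A → ℕ
  count P []       = 0
  count P (x ∷ xs) = if P x then suc (count P xs) else count P xs

  length-filter : {A : Set} (P : A → Bool) (xs : List A) → length (filter (λ x → T? (P x)) xs) ≡ count P xs
  length-filter P []       = refl
  length-filter P (x ∷ xs) with P x
  ... | true  = cong suc (length-filter P xs)
  ... | false = length-filter P xs

  count-cong : {A : Set} {P Q : A → Bool} → (∀ x → P x ≡ Q x) → ∀ xs → count P xs ≡ count Q xs
  count-cong         P≗Q []       = refl
  count-cong {Q = Q} P≗Q (x ∷ xs) rewrite P≗Q x with Q x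
  ... | true  = cong suc (count-cong P≗Q xs)
  ... | false = count-cong P≗Q xs

  count-none : {A : Set} {P : A → Bool} → (∀ x → P x ≡ false) → ∀ xs → count P xs ≡ 0
  count-none         P≗false []       = refl
  count-none {P = P} P≗false (x ∷ xs) rewrite P≗false x = count-none P≗false xs

  count-++ : {A : Set} (P : A → Bool) (xs ys : List A) → count P (xs ++ ys) ≡ count P xs + count P ys
  count-++ P []       ys = refl
  count-++ P (x ∷ xs) ys with P x
  ... | true  = cong suc (count-++ P xs ys)
  ... | false = count-++ P xs ys

  count-map : {A B : Set} (P : B → Bool) (f : A → B) (xs : List A) → count P (map f xs) ≡ count (P ∘ f) xs
  count-map P f []       = refl
  count-map P f (x ∷ xs) with P (f x)
  ... | true  = cong suc (count-map P f xs)
  ... | false = count-map P f xs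

  shift : (ℕ → ℕ) → ℕ → ℕ
  shift g zero    = 0
  shift g (suc j) = g j

  shift-cong : ∀ {g h} → (∀ i → g i ≡ h i) → ∀ j → shift g j ≡ shift h j
  shift-cong g≗h zero    = refl
  shift-cong g≗h (suc j) = g≗h j

  shift-+ : ∀ g h j → shift (λ i → g i + h i) j ≡ shift g j + shift h j
  shift-+ g h zero    = refl
  shift-+ g h (suc j) = refl

  sizeCount : ∀ {n} → (Subset n → Bool) → ℕ → ℕ
  sizeCount {n} P j = count (λ S → P S ∧ (∣ S ∣ ≡ᵇ j)) (allSubsets n)

  sizeCount-cong : ∀ {n} {P Q : Subset n → Bool} → (∀ S → P S ≡ Q S) → ∀ j → sizeCount P j ≡ sizeCount Q j
  sizeCount-cong {n} P≗Q j = count-cong (λ S → cong (_∧ (∣ S ∣ ≡ᵇ j)) (P≗Q S)) (allSubsets n)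

  sizeCount-suc : ∀ {n} (P : Subset (suc n) → Bool) j →
    sizeCount P j ≡ shift (sizeCount (P ∘ (true ∷_))) j + sizeCount (P ∘ (false ∷_)) j
  sizeCount-suc {n} P j = trans (count-++ Q (map (true ∷_) (allSubsets n)) (map (false ∷_) (allSubsets n)))
    (cong₂ _+_ (trans (count-map Q (true ∷_) (allSubsets n)) (withTrue j))
               (count-map Q (false ∷_) (allSubsets n)))
    where
    Q = λ S → P S ∧ (∣ S ∣ ≡ᵇ j)
    withTrue : ∀ j → count (λ S → P (true ∷ S) ∧ (suc ∣ S ∣ ≡ᵇ j)) (allSubsets n)
                     ≡ shift (sizeCount (P ∘ (true ∷_))) j
    withTrue zero    = count-none (λ S → ∧-zeroʳ (P (true ∷ S))) (allSubsets n)
    withTrue (suc j) = refl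

  sizeCount-vanish : ∀ {n} (P : Subset n → Bool) {j} → n < j → sizeCount P j ≡ 0
  sizeCount-vanish {n} P {j} n<j = count-none (λ S → trans (cong (P S ∧_) (∣S∣≢j S)) (∧-zeroʳ (P S))) (allSubsets n)
    where
    ∣S∣≢j : ∀ S → (∣ S ∣ ≡ᵇ j) ≡ false
    ∣S∣≢j S = dec-false (∣ S ∣ ℕ.≟ j) (ℕ.<⇒≢ (ℕ.≤-<-trans (∣p∣≤n S) n<j))

module GraphIndependence where

  open import Data.Bool using (Bool; true; false; _∧_; not; T)
  open import Data.Bool.Properties using (T-∧)
  open import Data.Empty using (⊥)
  open import Data.Fin using (Fin) renaming (zero to fzero; suc to fsuc)
  open import Data.Fin.Subset using (Subset)
  open import Data.List using (tabulate; allFin)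
  open import Data.Nat using (zero; suc)
  open import Data.Product using (_,_; proj₁; proj₂)
  open import Data.Unit using (tt)
  open import Data.Vec using (lookup)
  open import Function using (_∘_; _⇔_; mk⇔; Equivalence)

  Independent : (G : Graph) → Subset (order G) → Set
  Independent G S = ∀ i j → T (adj G i j) → T (lookup S i) → T (lookup S j) → ⊥

  T-allᵇ-tabulate : ∀ {A : Set} {m} (p : A → Bool) (f : Fin m → A) → T (allᵇ p (tabulate f)) ⇔ (∀ i → T (p (f i)))
  T-allᵇ-tabulate {m = zero}  p f = mk⇔ (λ _ ()) (λ _ → tt)
  T-allᵇ-tabulate {m = suc m} p f = mk⇔
    (λ t → λ { fzero → proj₁ (Equivalence.to T-∧ t)
             ; (fsuc i) → Equivalence.to (T-allᵇ-tabulate p (f ∘ fsuc)) (proj₂ (Equivalence.to T-∧ t)) i })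
    (λ h → Equivalence.from T-∧ (h fzero , Equivalence.from (T-allᵇ-tabulate p (f ∘ fsuc)) (h ∘ fsuc)))

  T-not-∧₃ : ∀ a b c → T (not (a ∧ b ∧ c)) ⇔ (T a → T b → T c → ⊥)
  T-not-∧₃ true  true  true  = mk⇔ (λ ()) (λ h → h tt tt tt)
  T-not-∧₃ true  true  false = mk⇔ (λ _ _ _ ()) (λ _ → tt)
  T-not-∧₃ true  false c     = mk⇔ (λ _ _ ()) (λ _ → tt)
  T-not-∧₃ false b     c     = mk⇔ (λ _ ()) (λ _ → tt)

  T-isIndependent : ∀ G S → T (isIndependent G S) ⇔ Independent G S
  T-isIndependent G S = mk⇔
    (λ t i j → Equivalence.to (T-not-∧₃ _ _ _)
                 (Equivalence.to (T-allᵇ-tabulate (noEdgeFrom i) (λ j → j))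
                   (Equivalence.to (T-allᵇ-tabulate noEdge (λ i → i)) t i) j))
    (λ ind → Equivalence.from (T-allᵇ-tabulate noEdge (λ i → i))
               (λ i → Equivalence.from (T-allᵇ-tabulate (noEdgeFrom i) (λ j → j))
                        (λ j → Equivalence.from (T-not-∧₃ _ _ _) (ind i j))))
    where
    noEdgeFrom : Fin (order G) → Fin (order G) → Bool
    noEdgeFrom i j = not (adj G i j ∧ lookup S i ∧ lookup S j)
    noEdge : Fin (order G) → Bool
    noEdge i = allᵇ (noEdgeFrom i) (allFin (order G))

module CycleIndependentSets where

  open GraphIndependence using (Independent; T-isIndependent)
  open import Data.Bool using (Bool; true; false; _∧_; not; T)
  open import Data.Bool.Properties using (T?; T-∧; T-∨; T-≡; ⇔→≡)
  open import Data.Empty using (⊥-elim)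
  open import Data.Fin using (Fin; toℕ; fromℕ<) renaming (zero to fzero; suc to fsuc)
  open import Data.Fin.Properties using (toℕ<n; toℕ-fromℕ<)
  open import Data.Nat using (ℕ; zero; suc; _<_; _%_; z<s; s<s)
  open import Data.Nat.DivMod using (m<n⇒m%n≡m; n%n≡0)
  import Data.Nat.Properties as ℕ
  open import Data.Product using (∃₂; _×_; _,_; proj₂)
  open import Data.Sum using (_⊎_; inj₁; inj₂)
  open import Data.Unit using (tt)
  open import Data.Vec using (Vec; []; _∷_; lookup)
  open import Function using (_∘_; _⇔_; mk⇔; Equivalence)
  import Function.Properties.Equivalence as ⇔
  open import Relation.Binary.PropositionalEquality using (_≡_; refl; sym; trans; cong; subst)
  open import Relation.Nullary using (¬_)
  open import Relation.Nullary.Decidable using (decidable-stable)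

  -- independentPath a b v: no two consecutive trues in b ∷ v followed by a.  For a
  -- subset s ∷ v of the cycle, a = b = s closes the path up.
  independentPath : ∀ {n} → Bool → Bool → Vec Bool n → Bool
  independentPath a b []      = not (b ∧ a)
  independentPath a b (c ∷ v) = not (b ∧ c) ∧ independentPath a c v

  independentCycle : ∀ {n} → Vec Bool (suc n) → Bool
  independentCycle (s ∷ v) = independentPath s s v

  bitAt : ∀ {n} → Vec Bool n → ℕ → Bool
  bitAt []      _       = false
  bitAt (b ∷ v) zero    = b
  bitAt (b ∷ v) (suc i) = bitAt v i

  lookup≡bitAt : ∀ {n} (v : Vec Bool n) i → lookup v i ≡ bitAt v (toℕ i)
  lookup≡bitAt (b ∷ v) fzero    = refl
  lookup≡bitAt (b ∷ v) (fsuc i) = lookup≡bitAt v i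

  lookup⇒bitAt : ∀ {n} (v : Vec Bool n) i → T (lookup v i) → T (bitAt v (toℕ i))
  lookup⇒bitAt v i = subst T (lookup≡bitAt v i)

  bitAt⇒lookup : ∀ {n i} (v : Vec Bool n) (i<n : i < n) → T (bitAt v i) → T (lookup v (fromℕ< i<n))
  bitAt⇒lookup v i<n = subst T (sym (trans (lookup≡bitAt v (fromℕ< i<n)) (cong (bitAt v) (toℕ-fromℕ< i<n))))

  Clash : ∀ {n} → Bool → Bool → Vec Bool n → Set
  Clash {n} a b v = (∃₂ λ i (_ : i < n) → T (bitAt (b ∷ v) i) × T (bitAt (b ∷ v) (suc i)))
                  ⊎ (T (bitAt (b ∷ v) n) × T a)

  Clash-∷ : ∀ {n} a b c (v : Vec Bool n) → Clash a c v → Clash a b (c ∷ v)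
  Clash-∷ a b c v (inj₁ (i , i<n , hᵢ , hᵢ₊₁)) = inj₁ (suc i , s<s i<n , hᵢ , hᵢ₊₁)
  Clash-∷ a b c v (inj₂ clash)                 = inj₂ clash

  Clash⇒¬independentPath : ∀ {n} a b (v : Vec Bool n) → Clash a b v → ¬ T (independentPath a b v)
  Clash⇒¬independentPath true  true  []      (inj₂ _) ()
  Clash⇒¬independentPath a     true  (true ∷ v)  (inj₁ (zero , _)) ()
  Clash⇒¬independentPath a     false (c ∷ v)     (inj₁ (zero , _ , () , _))
  Clash⇒¬independentPath a     true  (false ∷ v) (inj₁ (zero , _ , _ , ()))
  Clash⇒¬independentPath a b (c ∷ v) (inj₁ (suc i , s<s i<n , hᵢ , hᵢ₊₁)) t =
    Clash⇒¬independentPath a c v (inj₁ (i , i<n , hᵢ , hᵢ₊₁)) (proj₂ (Equivalence.to T-∧ t))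
  Clash⇒¬independentPath a b (c ∷ v) (inj₂ clash) t =
    Clash⇒¬independentPath a c v (inj₂ clash) (proj₂ (Equivalence.to T-∧ t))

  ¬independentPath⇒Clash : ∀ {n} a b (v : Vec Bool n) → ¬ T (independentPath a b v) → Clash a b v
  ¬independentPath⇒Clash true  true  []          _  = inj₂ (tt , tt)
  ¬independentPath⇒Clash false true  []          ¬t = ⊥-elim (¬t tt)
  ¬independentPath⇒Clash a     false []          ¬t = ⊥-elim (¬t tt)
  ¬independentPath⇒Clash a     true  (true ∷ v)  _  = inj₁ (0 , z<s , tt , tt)
  ¬independentPath⇒Clash a     true  (false ∷ v) ¬t = Clash-∷ a true false v (¬independentPath⇒Clash a false v ¬t)
  ¬independentPath⇒Clash a     false (c ∷ v)     ¬t = Clash-∷ a false c v (¬independentPath⇒Clash a c v ¬t)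

  adj-cycle⇒successor : ∀ {n} (i j : Fin (suc n)) → T (adj (cycleGraph (suc n)) i j) →
                        toℕ j ≡ suc (toℕ i) % suc n ⊎ toℕ i ≡ suc (toℕ j) % suc n
  adj-cycle⇒successor i j e with Equivalence.to T-∨ e
  ... | inj₁ j≡i+1 = inj₁ (ℕ.≡ᵇ⇒≡ _ _ j≡i+1)
  ... | inj₂ i≡j+1 = inj₂ (ℕ.≡ᵇ⇒≡ _ _ i≡j+1)

  successor⇒adj-cycle : ∀ {n} (i j : Fin (suc n)) → toℕ j ≡ suc (toℕ i) % suc n → T (adj (cycleGraph (suc n)) i j)
  successor⇒adj-cycle i j j≡i+1 = Equivalence.from T-∨ (inj₁ (ℕ.≡⇒≡ᵇ _ _ j≡i+1))

  successor⇒Clash : ∀ {n} s (v : Vec Bool n) a b → a < suc n → b ≡ suc a % suc n →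
                    T (bitAt (s ∷ v) a) → T (bitAt (s ∷ v) b) → Clash s s v
  successor⇒Clash {n} s v a b a<1+n b≡a+1 hₐ h_b with ℕ.m<1+n⇒m<n∨m≡n a<1+n
  ... | inj₁ a<n  = inj₁ (a , a<n , hₐ , subst (T ∘ bitAt (s ∷ v)) (trans b≡a+1 (m<n⇒m%n≡m (s<s a<n))) h_b)
  ... | inj₂ refl = inj₂ (hₐ , subst (T ∘ bitAt (s ∷ v)) (trans b≡a+1 (n%n≡0 (suc n))) h_b)

  adj-cycle⇒Clash : ∀ {n} s (v : Vec Bool n) i j → T (adj (cycleGraph (suc n)) i j) →
                    T (lookup (s ∷ v) i) → T (lookup (s ∷ v) j) → Clash s s v
  adj-cycle⇒Clash s v i j e hᵢ hⱼ with adj-cycle⇒successor i j e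
  ... | inj₁ j≡i+1 =
    successor⇒Clash s v (toℕ i) (toℕ j) (toℕ<n i) j≡i+1 (lookup⇒bitAt (s ∷ v) i hᵢ) (lookup⇒bitAt (s ∷ v) j hⱼ)
  ... | inj₂ i≡j+1 =
    successor⇒Clash s v (toℕ j) (toℕ i) (toℕ<n j) i≡j+1 (lookup⇒bitAt (s ∷ v) j hⱼ) (lookup⇒bitAt (s ∷ v) i hᵢ)

  Clash⇒adj-cycle : ∀ {n} s (v : Vec Bool n) → Clash s s v →
                    ∃₂ λ i j → T (adj (cycleGraph (suc n)) i j) × T (lookup (s ∷ v) i) × T (lookup (s ∷ v) j)
  Clash⇒adj-cycle {n} s v (inj₁ (i , i<n , hᵢ , hᵢ₊₁)) =
    fromℕ< i<1+n , fromℕ< (s<s i<n) ,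
    successor⇒adj-cycle (fromℕ< i<1+n) (fromℕ< (s<s i<n))
      (trans (toℕ-fromℕ< (s<s i<n))
        (sym (trans (cong (λ k → suc k % suc n) (toℕ-fromℕ< i<1+n)) (m<n⇒m%n≡m (s<s i<n))))) ,
    bitAt⇒lookup (s ∷ v) i<1+n hᵢ , bitAt⇒lookup (s ∷ v) (s<s i<n) hᵢ₊₁
    where
    i<1+n : i < suc n
    i<1+n = ℕ.m<n⇒m<1+n i<n
  Clash⇒adj-cycle {n} s v (inj₂ (hₙ , hₛ)) =
    fromℕ< n<1+n , fzero ,
    successor⇒adj-cycle (fromℕ< n<1+n) fzero
      (sym (trans (cong (λ k → suc k % suc n) (toℕ-fromℕ< n<1+n)) (n%n≡0 (suc n)))) ,
    bitAt⇒lookup (s ∷ v) n<1+n hₙ , hₛ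
    where
    n<1+n : n < suc n
    n<1+n = ℕ.n<1+n n

  T-independentCycle : ∀ {n} (S : Vec Bool (suc n)) → T (independentCycle S) ⇔ Independent (cycleGraph (suc n)) S
  T-independentCycle (s ∷ v) = mk⇔
    (λ t i j e hᵢ hⱼ → Clash⇒¬independentPath s s v (adj-cycle⇒Clash s v i j e hᵢ hⱼ) t)
    λ ind → decidable-stable (T? _) λ ¬t →
      let i , j , e , hᵢ , hⱼ = Clash⇒adj-cycle s v (¬independentPath⇒Clash s s v ¬t) in ind i j e hᵢ hⱼ

  isIndependent-cycle : ∀ {n} (S : Vec Bool (suc n)) → isIndependent (cycleGraph (suc n)) S ≡ independentCycle S
  isIndependent-cycle {n} S = ⇔→≡ (⇔.trans (⇔.sym T-≡)
    (⇔.trans (T-isIndependent (cycleGraph (suc n)) S) (⇔.trans (⇔.sym (T-independentCycle S)) T-≡)))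

module CycleCounting where

  open IntegerPolynomials using (1ₚ; X; coeff-+ₚ; 0∷-*ₚ; ∷-cong; *ₚ-identityˡ)
  open LucasPolynomials using (lucas)
  open SubsetCounting
  open CycleIndependentSets using (independentPath; independentCycle)
  open import Data.Bool using (Bool; true; false)
  open import Data.Integer using (+_) renaming (_+_ to _+ᶻ_)
  import Data.Integer.Properties as ℤ
  open import Data.List using (_∷_)
  open import Data.Nat using (ℕ; zero; suc; _+_)
  open import Data.Nat.Tactic.RingSolver using (solve-∀)
  open import Relation.Binary.PropositionalEquality
    using (_≡_; refl; sym; trans; cong; cong₂; module ≡-Reasoning)
  open ≡-Reasoning

  pathCount : Bool → Bool → ℕ → ℕ → ℕ
  pathCount a b n = sizeCount {n} (independentPath a b)

  cycleCount : ℕ → ℕ → ℕ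
  cycleCount n = sizeCount {suc n} independentCycle

  pathCount-true : ∀ a n j → pathCount a true (suc n) j ≡ pathCount a false n j
  pathCount-true a n j = trans (sizeCount-suc {n} (independentPath a true) j) (cong (_+ pathCount a false n j) (noTrue j))
    where
    noTrue : ∀ j → shift (sizeCount {n} (λ _ → false)) j ≡ 0
    noTrue zero    = refl
    noTrue (suc j) = count-none (λ _ → refl) (allSubsets n)

  pathCount-false : ∀ a n j → pathCount a false (suc n) j ≡ shift (pathCount a true n) j + pathCount a false n j
  pathCount-false a n = sizeCount-suc {n} (independentPath a false)

  cycleCount≡pathCounts : ∀ n j → cycleCount n j ≡ shift (pathCount true true n) j + pathCount false false n j
  cycleCount≡pathCounts n = sizeCount-suc {n} independentCycle

  cycleCount-recurrence : ∀ m j → cycleCount (suc (suc m)) j ≡ cycleCount (suc m) j + shift (cycleCount m) j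
  cycleCount-recurrence m j = begin
    cycleCount (suc (suc m)) j
      ≡⟨ cycleCount≡pathCounts (suc (suc m)) j ⟩
    shift (pathCount true true (suc (suc m))) j + pathCount false false (suc (suc m)) j
      ≡⟨ cong₂ _+_ (shift-cong (λ i → trans (pathCount-true true (suc m) i) (pathCount-false true m i)) j)
                   (trans (pathCount-false false (suc m) j)
                          (cong (_+ F (suc m) j) (shift-cong (pathCount-true false m) j))) ⟩
    shift (λ i → shift (TT m) i + T m i) j + (shift (F m) j + F (suc m) j)
      ≡⟨ cong (_+ (shift (F m) j + F (suc m) j)) (shift-+ (shift (TT m)) (T m) j) ⟩
    shift (shift (TT m)) j + shift (T m) j + (shift (F m) j + F (suc m) j)
      ≡⟨ regroup (shift (shift (TT m)) j) (shift (T m) j) (shift (F m) j) (F (suc m) j) ⟩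
    (shift (T m) j + F (suc m) j) + (shift (shift (TT m)) j + shift (F m) j)
      ≡⟨ sym (cong₂ _+_ (trans (cycleCount≡pathCounts (suc m) j)
                               (cong (_+ F (suc m) j) (shift-cong (pathCount-true true m) j)))
                        (trans (shift-cong (cycleCount≡pathCounts m) j) (shift-+ (shift (TT m)) (F m) j))) ⟩
    cycleCount (suc m) j + shift (cycleCount m) j
      ∎
    where
    TT = pathCount true true
    T  = pathCount true false
    F  = pathCount false false
    regroup : ∀ a b c d → a + b + (c + d) ≡ (b + d) + (a + c)
    regroup = solve-∀

  coeff-lucas-recurrence : ∀ n j → coeff (lucas (suc (suc n))) j ≡ coeff (lucas (suc n)) j +ᶻ coeff (+ 0 ∷ lucas n) j
  coeff-lucas-recurrence n j = trans (coeff-+ₚ (lucas (suc n)) (X *ₚ lucas n) j)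
    (cong (coeff (lucas (suc n)) j +ᶻ_) (trans (0∷-*ₚ 1ₚ (lucas n) j) (∷-cong (+ 0) (*ₚ-identityˡ (lucas n)) j)))

  +-shift : ∀ {g p} → (∀ i → + g i ≡ coeff p i) → ∀ j → + shift g j ≡ coeff (+ 0 ∷ p) j
  +-shift g≗p zero    = refl
  +-shift g≗p (suc j) = g≗p j

  cycleCount≡coeff-lucas : ∀ m j → + cycleCount m j ≡ coeff (lucas (suc m)) j
  cycleCount≡coeff-lucas zero          zero                = refl
  cycleCount≡coeff-lucas zero          (suc j)             = refl
  cycleCount≡coeff-lucas (suc zero)    zero                = refl
  cycleCount≡coeff-lucas (suc zero)    (suc zero)          = refl
  cycleCount≡coeff-lucas (suc zero)    (suc (suc zero))    = refl
  cycleCount≡coeff-lucas (suc zero)    (suc (suc (suc j))) = refl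
  cycleCount≡coeff-lucas (suc (suc m)) j = begin
    + cycleCount (suc (suc m)) j                                  ≡⟨ cong +_ (cycleCount-recurrence m j) ⟩
    + (cycleCount (suc m) j + shift (cycleCount m) j)             ≡⟨ ℤ.pos-+ (cycleCount (suc m) j) (shift (cycleCount m) j) ⟩
    + cycleCount (suc m) j +ᶻ + shift (cycleCount m) j            ≡⟨ cong₂ _+ᶻ_ (cycleCount≡coeff-lucas (suc m) j)
                                                                       (+-shift (cycleCount≡coeff-lucas m) j) ⟩
    coeff (lucas (suc (suc m))) j +ᶻ coeff (+ 0 ∷ lucas (suc m)) j ≡⟨ sym (coeff-lucas-recurrence (suc m) j) ⟩
    coeff (lucas (suc (suc (suc m)))) j                           ∎

module IndependencePolynomialOfCycles where

  open LucasPolynomials using (lucas)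
  open SubsetCounting using (length-filter; sizeCount; sizeCount-cong; sizeCount-vanish)
  open CycleCounting using (cycleCount; cycleCount≡coeff-lucas)
  open CycleIndependentSets using (isIndependent-cycle)
  open import Data.Integer using (ℤ; +_)
  open import Data.List using (map; applyUpTo)
  open import Data.Nat using (ℕ; zero; suc; _≤_; _<_; s≤s; z≤n)
  open import Relation.Binary.PropositionalEquality using (_≡_; refl; sym; trans; cong; module ≡-Reasoning)
  open ≡-Reasoning

  coeff-map-applyUpTo : ∀ (f : ℕ → ℤ) g n j → (n ≤ j → f (g j) ≡ + 0) → coeff (map f (applyUpTo g n)) j ≡ f (g j)
  coeff-map-applyUpTo f g zero    j       vanish = sym (vanish z≤n)
  coeff-map-applyUpTo f g (suc n) zero    vanish = refl
  coeff-map-applyUpTo f g (suc n) (suc j) vanish = coeff-map-applyUpTo f (λ i → g (suc i)) n j (λ n≤j → vanish (s≤s n≤j))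

  indepCount≡sizeCount : ∀ G j → indepCount G j ≡ sizeCount (isIndependent G) j
  indepCount≡sizeCount G j = length-filter _ (allSubsets (order G))

  coeff-indepPoly : ∀ G j → coeff (indepPoly G) j ≡ + indepCount G j
  coeff-indepPoly G j = coeff-map-applyUpTo (λ i → + indepCount G i) (λ i → i) (suc (order G)) j
    (λ order<j → cong +_ (trans (indepCount≡sizeCount G j) (sizeCount-vanish (isIndependent G) order<j)))

  indepPoly-cycle : ∀ {n} → 0 < n → indepPoly (cycleGraph n) ≈ₚ lucas n
  indepPoly-cycle {suc m} _ j = begin
    coeff (indepPoly (cycleGraph (suc m))) j                        ≡⟨ coeff-indepPoly (cycleGraph (suc m)) j ⟩
    + indepCount (cycleGraph (suc m)) j                            ≡⟨ cong +_ (indepCount≡sizeCount (cycleGraph (suc m)) j) ⟩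
    + sizeCount (isIndependent (cycleGraph (suc m))) j             ≡⟨ cong +_ (sizeCount-cong {suc m} isIndependent-cycle j) ⟩
    + cycleCount m j                                               ≡⟨ cycleCount≡coeff-lucas m j ⟩
    coeff (lucas (suc m)) j                                        ∎

open IntegerPolynomials using (∣ₚ-resp-≈ₚ)
open LucasPolynomials using (lucas; lucas∣ₚlucas-odd-multiple)
open LucasNumbers using (lucas∣ₚlucas⇒lucasNumber∣lucasNumber; lucasNumber∣⇒∣)
open IndependencePolynomialOfCycles using (indepPoly-cycle)
open import Data.Nat using (zero; suc; _*_; _+_; s≤s; z≤n)
import Data.Nat.Properties as ℕ
open import Data.Nat.DivMod using ([m+kn]%n≡m%n)
open import Data.Nat.Divisibility using (divides)
open import Data.Nat.Tactic.RingSolver using (solve-∀)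
open import Data.Product using (∃; _,_)
open import Function using (_∘_)
open import Function.Bundles using (mk⇔)
open import Relation.Binary.PropositionalEquality using (refl; sym; trans; cong; subst)

odd-factor : ∀ q k → (q * k) % 2 ≡ 1 → ∃ λ t → q ≡ suc (t * 2)
odd-factor zero          k ()
odd-factor (suc zero)    k _      = 0 , refl
odd-factor (suc (suc q)) k [q+2]k-odd =
  let t , q≡2t+1 = odd-factor q k qk-odd in suc t , cong (suc ∘ suc) q≡2t+1
  where
  index : ∀ q k → q * k + k * 2 ≡ suc (suc q) * k
  index = solve-∀
  qk-odd : (q * k) % 2 ≡ 1
  qk-odd = trans (sym ([m+kn]%n≡m%n (q * k) k 2)) (trans (cong (_% 2) (index q k)) [q+2]k-odd)

corollary17 : (n k : ℕ) → 3 ≤ n → n % 2 ≡ 1 → 3 ≤ k →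
    (k ∣ n) ⇔ (indepPoly (cycleGraph k) ∣ₚ indepPoly (cycleGraph n))
corollary17 n k 3≤n n-odd 3≤k = mk⇔ to from
  where
  Cₖ = indepPoly (cycleGraph k)
  Cₙ = indepPoly (cycleGraph n)
  Cₖ≈Lₖ : Cₖ ≈ₚ lucas k
  Cₖ≈Lₖ = indepPoly-cycle (ℕ.<-≤-trans (s≤s z≤n) 3≤k)
  Cₙ≈Lₙ : Cₙ ≈ₚ lucas n
  Cₙ≈Lₙ = indepPoly-cycle (ℕ.<-≤-trans (s≤s z≤n) 3≤n)
  to : k ∣ n → Cₖ ∣ₚ Cₙ
  to (divides q n≡qk) with odd-factor q k (subst (λ m → m % 2 ≡ 1) n≡qk n-odd)
  ... | t , refl = ∣ₚ-resp-≈ₚ {lucas k} {Cₖ} {lucas n} {Cₙ} (λ j → sym (Cₖ≈Lₖ j)) (λ j → sym (Cₙ≈Lₙ j))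
                     (subst (λ m → lucas k ∣ₚ lucas m) (sym n≡qk) (lucas∣ₚlucas-odd-multiple k t))
  from : Cₖ ∣ₚ Cₙ → k ∣ n
  from Cₖ∣Cₙ = lucasNumber∣⇒∣ (ℕ.<⇒≤ 3≤k) n
    (lucas∣ₚlucas⇒lucasNumber∣lucasNumber k n (∣ₚ-resp-≈ₚ {Cₖ} {lucas k} {Cₙ} {lucas n} Cₖ≈Lₖ Cₙ≈Lₙ Cₖ∣Cₙ))
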